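{- Let $0\le i\le j$ be integers and let $(G,\mathbf t)$ be an $(i,j)$-critical weighted pair. If $v\in V(G)$ has degree $d_G(v)=1$, then $\mathbf t(v)\geq i+1$.
   Context: Multigraphs are finite without loops. A 2-fold cover of a multigraph $G$ is a pair $(L,\mathcal H)$ where $\mathcal H$ is a graph and $L$ assigns to each $v\in V(G)$ a 2-element set $L(v)=\{p(v),r(v)\}$ ($p(v)$ poor, $r(v)$ rich) such that the sets $L(v)$ partition $V(\mathcal H)$, $p(v)r(v)\in E(\mathcal H)$, edges of $\mathcal H$ between $L(u)$ and $L(v)$ ($u\ne v$) exist only if $uv\in E(G)$, and if $u,v$ are joined by $k\ge1$ edges then $\mathcal H[L(u),L(v)]$ is a union of at most $k$ perfect matchings between $L(u)$ and $L(v)$. An $\mathcal H$-map is a function $\phi$ with $\phi(v)\in L(v)$; $\mathcal H_\phi$ is the subgraph of $\mathcal H$ induced by $\phi(V(G))$. A toughness function on $G$ is a map $\mathbf t:V(G)\to\{0,1,\dots,j+1\}$, and $(G,\mathbf t)$ is a weighted pair. An $(i,j,\mathbf t)$-coloring of a cover $\mathcal H$ is an $\mathcal H$-map $\phi$ such that for every $v$, if $\phi(v)=p(v)$ then its degree in $\mathcal H_\phi$ is at most $i-\mathbf t(v)$, and if $\phi(v)=r(v)$ then its degree in $\mathcal H_\phi$ is at most $j-\mathbf t(v)$ (a negative bound forbids that choice). $(G,\mathbf t)$ is $(i,j)$-critical if some 2-fold cover of $G$ has no $(i,j,\mathbf t)$-coloring, but for every proper subgraph $G'$ of $G$, every 2-fold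 cover of $G'$ has an $(i,j,\mathbf t|_{V(G')})$-coloring. -}

module Defs where

open import Data.Nat using (ℕ; zero; suc; _+_; _≤_; _<_)
open import Data.Bool using (Bool; true; false; if_then_else_; _∧_; not)
open import Data.Fin using (Fin; zero; suc; _≟_)
open import Data.List using (List; length)
open import Data.List.Relation.Unary.Any using (Any)
open import Data.Product using (Σ; ∃; ∃-syntax; _×_)
open import Data.Sum using (_⊎_)
open import Function using (_∘_; _⇔_)
open import Function.Definitions using (Injective)
open import Relation.Binary.PropositionalEquality using (_≡_; _≢_)
open import Relation.Nullary using (¬_; does)

count : ∀ {n} → (Fin n → Bool) → ℕ
count {zero}  f = 0
count {suc n} f = (if f zero then 1 else 0) + count (f ∘ suc)

sumF : ∀ {n} → (Fin n → ℕ) → ℕ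
sumF {zero}  f = 0
sumF {suc n} f = f zero + sumF (f ∘ suc)

-- A loopless multigraph whose vertex set is a subset of Fin n
-- (given by inV); mult u v = number of edges between u and v.
-- A finite multigraph on Fin n is one with inV v ≡ true for all v.
record MG (n : ℕ) : Set where
  field
    inV     : Fin n → Bool
    mult    : Fin n → Fin n → ℕ
    mult-sym : ∀ u v → mult u v ≡ mult v u
    loopless : ∀ v → mult v v ≡ 0
    outside  : ∀ u v → inV u ≡ false → mult u v ≡ 0
open MG public

degree : ∀ {n} → MG n → Fin n → ℕ
degree G v = sumF (mult G v)

Subgraph : ∀ {n} → MG n → MG n → Set
Subgraph G' G = (∀ v → inV G' v ≡ true → inV G v ≡ true)
              × (∀ u v → mult G' u v ≤ mult G u v)

-- G' ≠ G (given G' is a subgraph of G)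
Proper : ∀ {n} → MG n → MG n → Set
Proper G' G = (∃[ v ] (inV G v ≡ true × inV G' v ≡ false))
            ⊎ (∃[ u ] ∃[ v ] (mult G' u v < mult G u v))

-- A perfect matching between L(u) and L(v) (both 2-element sets,
-- identified with Bool) is a bijection Bool → Bool.
PerfectMatching : Set
PerfectMatching = Σ (Bool → Bool) (λ f → Injective _≡_ _≡_ f)

-- A 2-fold cover of G.  V(H) = { (v , b) : v ∈ V(G), b : Bool },
-- L(v) = {(v,false),(v,true)}, p(v) = (v,false) poor, r(v) = (v,true) rich.
-- edge u a v b : whether (u,a)(v,b) ∈ E(H).
record Cover {n : ℕ} (G : MG n) : Set where
  field
    edge     : Fin n → Bool → Fin n → Bool → Bool
    edge-sym : ∀ u a v b → edge u a v b ≡ edge v b u a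
    within   : ∀ v → inV G v ≡ true → ∀ a b →
               (edge v a v b ≡ true) ⇔ (a ≢ b)
    -- H[L(u),L(v)] is a union of at most mult u v perfect matchings
    -- (in particular empty unless uv ∈ E(G))
    between  : ∀ u v → u ≢ v → inV G u ≡ true → inV G v ≡ true →
               Σ (List PerfectMatching) λ Ms →
                 (length Ms ≤ mult G u v) ×
                 (∀ a b → (edge u a v b ≡ true)
                          ⇔ Any (λ M → Σ.proj₁ M a ≡ b) Ms)
open Cover public

-- degree of φ(v) in H_φ, where φ v = true means φ(v) = r(v)
degφ : ∀ {n} {G : MG n} → Cover G → (Fin n → Bool) → Fin n → ℕ
degφ {G = G} H φ v =
  count (λ u → inV G u ∧ not (does (u ≟ v)) ∧ edge H v (φ v) u (φ u))

IsColoring : ∀ {n} {G : MG n} → ℕ → ℕ → (Fin n → ℕ) →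
             Cover G → (Fin n → Bool) → Set
IsColoring {G = G} i j t H φ =
  ∀ v → inV G v ≡ true →
    degφ H φ v + t v ≤ (if φ v then j else i)

Colorable : ∀ {n} {G : MG n} → ℕ → ℕ → (Fin n → ℕ) → Cover G → Set
Colorable i j t H = ∃[ φ ] IsColoring i j t H φ

Critical : ∀ {n} → ℕ → ℕ → MG n → (Fin n → ℕ) → Set
Critical i j G t =
  (∃[ H ] ¬ Colorable {G = G} i j t H)
  × (∀ (G' : MG _) → Subgraph G' G → Proper G' G →
       ∀ (H : Cover G') → Colorable i j t H)

module Submission where

-- Suppose t(v) ≤ i and let u be the unique neighbour of v.  Detaching v from G
-- (deleting the edge uv) gives a proper subgraph, so by criticality the cover
-- obtained from the uncolorable cover H by deleting all edges between L(v) and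
-- the other lists has an (i,j,t)-coloring φ.  As u and v are joined by a single
-- edge, H[L(u),L(v)] is at most one perfect matching, so some colour b ∈ L(v) is
-- not adjacent to φ(u); no other list is joined to L(v) at all.  Recolouring v
-- by b colours H: b is isolated in H_φ, so its demand t(v) ≤ i ≤ j is met, and
-- every other vertex keeps its degree.  This contradicts the choice of H.

open import Defs
open import Data.Nat using (ℕ; zero; suc; _≤_; _<_; _+_; z≤n; s≤s)
open import Data.Nat.Properties
  using (≤-refl; ≤-trans; ≤-reflexive; _≤?_; ≰⇒>; n≮0; suc-injective; m+n≡0⇒m≡0; m+n≡0⇒n≡0)
open import Data.Bool using (Bool; true; false; if_then_else_; _∧_; not; _xor_)
open import Data.Bool.Properties using (∧-zeroʳ; xor-comm; xor-same; not-¬; ¬-not)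
open import Data.Fin using (Fin; zero; suc; _≟_)
open import Data.List using (List; []; _∷_; length)
open import Data.List.Relation.Unary.Any using (Any; here; there)
open import Data.Product using (Σ; ∃-syntax; _×_; _,_; proj₁)
open import Data.Sum using (inj₂)
open import Data.Vec.Functional using (updateAt)
open import Data.Vec.Functional.Properties using (updateAt-updates; updateAt-minimal)
open import Function using (_∘_; const; _⇔_)
open import Function.Bundles using (Equivalence; mk⇔)
open import Relation.Binary.PropositionalEquality
  using (_≡_; _≢_; refl; sym; trans; cong; cong₂; subst; ≢-sym)
open import Relation.Nullary using (¬_; Dec; does; yes; no; contradiction)
open import Relation.Nullary.Decidable using (dec-true; dec-false)

sumF-zero : ∀ {n} (f : Fin n → ℕ) → sumF f ≡ 0 → ∀ x → f x ≡ 0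
sumF-zero f sum≡0 zero    = m+n≡0⇒m≡0 (f zero) sum≡0
sumF-zero f sum≡0 (suc x) = sumF-zero (f ∘ suc) (m+n≡0⇒n≡0 (f zero) sum≡0) x

sumF-one : ∀ {n} (f : Fin n → ℕ) → sumF f ≡ 1 →
           ∃[ y ] (f y ≡ 1 × (∀ x → x ≢ y → f x ≡ 0))
sumF-one {zero} f ()
sumF-one {suc n} f sum≡1 with f zero in f0≡
... | zero with sumF-one (f ∘ suc) sum≡1
...   | y , fy≡1 , others =
        suc y , fy≡1 , λ { zero _ → f0≡ ; (suc x) x≢y → others x (x≢y ∘ cong suc) }
sumF-one {suc n} f sum≡1 | suc zero =
  zero , f0≡ , λ { zero 0≢0 → contradiction refl 0≢0
                 ; (suc x) _ → sumF-zero (f ∘ suc) (suc-injective sum≡1) x }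
sumF-one {suc n} f () | suc (suc _)

count-cong : ∀ {n} {f g : Fin n → Bool} → (∀ x → f x ≡ g x) → count f ≡ count g
count-cong {zero}  _   = refl
count-cong {suc n} f≗g =
  cong₂ _+_ (cong (λ b → if b then 1 else 0) (f≗g zero)) (count-cong (f≗g ∘ suc))

count-none : ∀ {n} {f : Fin n → Bool} → (∀ x → f x ≡ false) → count f ≡ 0
count-none {zero}  _ = refl
count-none {suc n} none rewrite none zero = count-none (none ∘ suc)

degφ-cong : ∀ {n} {G G' : MG n} (H : Cover G) (H' : Cover G') {φ φ' : Fin n → Bool}
            (w : Fin n) → (∀ x → inV G x ≡ inV G' x) →
            (∀ x → x ≢ w → edge H w (φ w) x (φ x) ≡ edge H' w (φ' w) x (φ' x)) →
            degφ H φ w ≡ degφ H' φ' w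
degφ-cong {G = G} {G'} H H' {φ} {φ'} w sameV sameE = count-cong term
  where
  term : ∀ x → (inV G x ∧ not (does (x ≟ w)) ∧ edge H w (φ w) x (φ x))
             ≡ (inV G' x ∧ not (does (x ≟ w)) ∧ edge H' w (φ' w) x (φ' x))
  term x rewrite sameV x with x ≟ w
  ... | yes _   = refl
  ... | no x≢w  = cong (inV G' x ∧_) (sameE x x≢w)

degφ-zero : ∀ {n} {G : MG n} (H : Cover G) {φ : Fin n → Bool} (w : Fin n) →
            (∀ x → x ≢ w → edge H w (φ w) x (φ x) ≡ false) → degφ H φ w ≡ 0
degφ-zero {G = G} H {φ} w isolated = count-none term
  where
  term : ∀ x → (inV G x ∧ not (does (x ≟ w)) ∧ edge H w (φ w) x (φ x)) ≡ false
  term x with x ≟ w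
  ... | yes _  = ∧-zeroʳ (inV G x)
  ... | no x≢w rewrite isolated x x≢w = ∧-zeroʳ (inV G x)

adjacent-distinct : ∀ {n} (G : MG n) {u w : Fin n} → 0 < mult G u w → u ≢ w
adjacent-distinct G {u} 0<m refl = n≮0 (subst (0 <_) (loopless G u) 0<m)

unique-neighbour : ∀ {n} (G : MG n) (v : Fin n) → degree G v ≡ 1 →
                   ∃[ u ] (mult G u v ≡ 1 × (∀ w → w ≢ u → mult G v w ≡ 0))
unique-neighbour G v deg≡1 with sumF-one (mult G v) deg≡1
... | u , vu≡1 , others = u , trans (mult-sym G u v) vu≡1 , others

false-unless : ∀ {e : Bool} {P : Set} → (e ≡ true ⇔ P) → ¬ P → e ≡ false
false-unless e⇔P ¬P = ¬-not (¬P ∘ Equivalence.to e⇔P)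

no-cover-edge : ∀ {n} {G : MG n} (H : Cover G) {u w : Fin n} → u ≢ w →
                inV G u ≡ true → inV G w ≡ true → mult G u w ≡ 0 →
                ∀ a b → edge H u a w b ≡ false
no-cover-edge H u≢w iu iw m≡0 a b with between H _ _ u≢w iu iw
... | [] , _ , matched    = false-unless (matched a b) (λ ())
... | _ ∷ _ , length≤m , _ = contradiction (subst (_ ≤_) m≡0 length≤m) λ ()

-- Across at most one edge uw, H[L(u),L(w)] is at most one perfect matching, so
-- every colour of u has a non-adjacent colour in L(w).
free-colour : ∀ {n} {G : MG n} (H : Cover G) {u w : Fin n} → u ≢ w →
              inV G u ≡ true → inV G w ≡ true → mult G u w ≤ 1 →
              ∀ a → ∃[ b ] edge H u a w b ≡ false
free-colour H u≢w iu iw m≤1 a with between H _ _ u≢w iu iw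
... | [] , _ , matched = true , false-unless (matched a true) (λ ())
... | M ∷ [] , _ , matched =
      not (proj₁ M a) , false-unless (matched a _) λ { (here Ma≡¬Ma) → not-¬ refl Ma≡¬Ma
                                                     ; (there ()) }
... | _ ∷ _ ∷ _ , length≤m , _ = contradiction (≤-trans length≤m m≤1) λ { (s≤s ()) }

pendant-free-colour : ∀ {n} {G : MG n} (H : Cover G) → (∀ w → inV G w ≡ true) →
                      (v : Fin n) → degree G v ≡ 1 → (φ : Fin n → Bool) →
                      ∃[ b ] (∀ w → w ≢ v → edge H v b w (φ w) ≡ false)
pendant-free-colour {G = G} H allV v deg≡1 φ with unique-neighbour G v deg≡1
... | u , uv≡1 , others
  with free-colour H (adjacent-distinct G (≤-reflexive (sym uv≡1)))
                   (allV u) (allV v) (≤-reflexive uv≡1) (φ u)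
...   | b , ub-free = b , avoids
  where
  avoids : ∀ w → w ≢ v → edge H v b w (φ w) ≡ false
  avoids w w≢v with w ≟ u
  ... | yes refl = trans (edge-sym H v b w (φ w)) ub-free
  ... | no w≢u   = no-cover-edge H (≢-sym w≢v) (allV v) (allV w) (others w w≢u) b (φ w)

-- Detaching v from G: delete every edge of G between v and another vertex,
-- and every edge of a cover between L(v) and another list.  `crosses a b`
-- says that exactly one of a, b is v.
module Detach {n : ℕ} (G : MG n) (v : Fin n) where

  crosses : Fin n → Fin n → Bool
  crosses a b = does (a ≟ v) xor does (b ≟ v)

  crosses-sym : ∀ a b → crosses a b ≡ crosses b a
  crosses-sym a b = xor-comm (does (a ≟ v)) (does (b ≟ v))

  crosses-self : ∀ a → crosses a a ≡ false
  crosses-self a = xor-same (does (a ≟ v))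

  crosses-into : ∀ w → w ≢ v → crosses w v ≡ true
  crosses-into w w≢v rewrite dec-false (w ≟ v) w≢v | dec-true (v ≟ v) refl = refl

  crosses-away : ∀ a b → a ≢ v → b ≢ v → crosses a b ≡ false
  crosses-away a b a≢v b≢v rewrite dec-false (a ≟ v) a≢v | dec-false (b ≟ v) b≢v = refl

  mult∖ : Fin n → Fin n → ℕ
  mult∖ a b = if crosses a b then 0 else mult G a b

  mult∖-sym : ∀ a b → mult∖ a b ≡ mult∖ b a
  mult∖-sym a b = cong₂ (λ c m → if c then 0 else m) (crosses-sym a b) (mult-sym G a b)

  mult∖-loopless : ∀ a → mult∖ a a ≡ 0
  mult∖-loopless a =
    trans (cong (λ c → if c then 0 else mult G a a) (crosses-self a)) (loopless G a)

  mult∖-outside : ∀ a b → inV G a ≡ false → mult∖ a b ≡ 0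
  mult∖-outside a b a∉G with crosses a b
  ... | true  = refl
  ... | false = outside G a b a∉G

  mult∖-≤ : ∀ a b → mult∖ a b ≤ mult G a b
  mult∖-≤ a b with crosses a b
  ... | true  = z≤n
  ... | false = ≤-refl

  graph : MG n
  graph = record { inV = inV G ; mult = mult∖ ; mult-sym = mult∖-sym
                 ; loopless = mult∖-loopless ; outside = mult∖-outside }

  subgraph : Subgraph graph G
  subgraph = (λ _ a∈G → a∈G) , mult∖-≤

  proper : ∀ {u} → 0 < mult G u v → Proper graph G
  proper {u} 0<m = inj₂ (u , v , subst (_< mult G u v) (sym uv-deleted) 0<m)
    where
    uv-deleted : mult∖ u v ≡ 0
    uv-deleted = cong (λ c → if c then 0 else mult G u v)
                      (crosses-into u (adjacent-distinct G 0<m))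

  -- The detached cover of H: every edge between L(v) and another list is
  -- dropped, which deletes whole matchings, so it covers the detached graph.
  module _ (H : Cover G) where

    edge∖ : Fin n → Bool → Fin n → Bool → Bool
    edge∖ a x b y = if crosses a b then false else edge H a x b y

    edge∖-cut : ∀ {a x b y} → crosses a b ≡ true → edge∖ a x b y ≡ false
    edge∖-cut {a} {x} {b} {y} c = cong (λ k → if k then false else edge H a x b y) c

    edge∖-kept : ∀ {a x b y} → crosses a b ≡ false → edge∖ a x b y ≡ edge H a x b y
    edge∖-kept {a} {x} {b} {y} c = cong (λ k → if k then false else edge H a x b y) c

    edge∖-sym : ∀ a x b y → edge∖ a x b y ≡ edge∖ b y a x
    edge∖-sym a x b y =
      cong₂ (λ c e → if c then false else e) (crosses-sym a b) (edge-sym H a x b y)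

    edge∖-within : ∀ w → inV G w ≡ true → ∀ a b → (edge∖ w a w b ≡ true) ⇔ (a ≢ b)
    edge∖-within w w∈G a b rewrite edge∖-kept {w} {a} {w} {b} (crosses-self w) =
      within H w w∈G a b

    edge∖-between : ∀ a b → a ≢ b → inV G a ≡ true → inV G b ≡ true →
      Σ (List PerfectMatching) λ Ms → (length Ms ≤ mult∖ a b) ×
        (∀ x y → (edge∖ a x b y ≡ true) ⇔ Any (λ M → proj₁ M x ≡ y) Ms)
    edge∖-between a b a≢b a∈G b∈G with crosses a b
    ... | true  = [] , z≤n , λ _ _ → mk⇔ (λ ()) (λ ())
    ... | false = between H a b a≢b a∈G b∈G

    cover : Cover graph
    cover = record { edge = edge∖ ; edge-sym = edge∖-sym
                   ; within = edge∖-within ; between = edge∖-between }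

  -- A coloring φ of the detached cover extends to H by giving v a colour b that
  -- is adjacent to none of the colours φ(w): v then has degree 0 in H_ψ, so its
  -- demand t(v) ≤ i ≤ j is met, and every other vertex has the same neighbours
  -- in H_ψ as in the detached cover.
  extend : ∀ {i j : ℕ} {t : Fin n → ℕ} (H : Cover G) {φ : Fin n → Bool} →
           IsColoring i j t (cover H) φ → i ≤ j → t v ≤ i →
           (b : Bool) → (∀ w → w ≢ v → edge H v b w (φ w) ≡ false) →
           IsColoring i j t H (updateAt φ v (const b))
  extend {i} {j} {t} H {φ} col i≤j tv≤i b b-free = ψ-colours
    where
    ψ : Fin n → Bool
    ψ = updateAt φ v (const b)

    ψ-v : ψ v ≡ b
    ψ-v = updateAt-updates v φ

    ψ-away : ∀ w → w ≢ v → ψ w ≡ φ w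
    ψ-away w w≢v = updateAt-minimal w v φ w≢v

    isolated : ∀ x → x ≢ v → edge H v (ψ v) x (ψ x) ≡ false
    isolated x x≢v rewrite ψ-v | ψ-away x x≢v = b-free x x≢v

    same-degree : ∀ w → w ≢ v → degφ H ψ w ≡ degφ (cover H) φ w
    same-degree w w≢v = degφ-cong H (cover H) w (λ _ → refl) same-edges
      where
      same-edge : ∀ x → Dec (x ≡ v) → edge H w (ψ w) x (ψ x) ≡ edge∖ H w (φ w) x (φ x)
      same-edge x (yes refl) rewrite ψ-away w w≢v | ψ-v =
        trans (trans (edge-sym H w (φ w) v b) (b-free w w≢v))
              (sym (edge∖-cut H (crosses-into w w≢v)))
      same-edge x (no x≢v) rewrite ψ-away w w≢v | ψ-away x x≢v =
        sym (edge∖-kept H (crosses-away w x w≢v x≢v))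

      same-edges : ∀ x → x ≢ w → edge H w (ψ w) x (ψ x) ≡ edge∖ H w (φ w) x (φ x)
      same-edges x _ = same-edge x (x ≟ v)

    demand-met : ∀ c → t v ≤ (if c then j else i)
    demand-met true  = ≤-trans tv≤i i≤j
    demand-met false = tv≤i

    ψ-colours : IsColoring i j t H ψ
    ψ-colours w w∈G with w ≟ v
    ... | yes refl rewrite degφ-zero H v isolated | ψ-v = demand-met b
    ... | no w≢v rewrite same-degree w w≢v | ψ-away w w≢v = col w w∈G

pendant-extends : ∀ {n} {G : MG n} {i j : ℕ} {t : Fin n → ℕ} →
                  (∀ w → inV G w ≡ true) → i ≤ j → (v : Fin n) → degree G v ≡ 1 →
                  t v ≤ i → (H : Cover G) →
                  Colorable i j t (Detach.cover G v H) → Colorable i j t H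
pendant-extends {G = G} allV i≤j v deg≡1 tv≤i H (φ , col)
  with pendant-free-colour H allV v deg≡1 φ
... | b , b-free = updateAt φ v (const b) , Detach.extend G v H col i≤j tv≤i b b-free

lemma5p2 : (i j : ℕ) → i ≤ j → (n : ℕ) → (G : MG n) →
           (∀ v → inV G v ≡ true) →
           (t : Fin n → ℕ) → (∀ v → t v ≤ suc j) →
           Critical i j G t →
           (v : Fin n) → degree G v ≡ 1 → suc i ≤ t v
lemma5p2 i j i≤j n G allV t _ ((H , H-uncolorable) , minimal) v deg≡1
  with t v ≤? i | unique-neighbour G v deg≡1
... | no tv≰i   | _ = ≰⇒> tv≰i
... | yes tv≤i  | u , uv≡1 , _ =
      contradiction (pendant-extends allV i≤j v deg≡1 tv≤i H detached-colorable) H-uncolorable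
  where
  open Detach G v
  detached-colorable : Colorable i j t (cover H)
  detached-colorable = minimal graph subgraph (proper (≤-reflexive (sym uv≡1))) (cover H)
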